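{- Let $R$ be a ring with unity, let $p_1,\dots,p_k$ be restricted polynomial expressions over $R$, and let $q$ be the expansion of $\prod_{i=1}^k p_i$. Then $|q|\le\big(\sum_{i=1}^k|p_i|\big)\big(\prod_{i=1}^k|p_i|\big)$.
   Context: A restricted monomial expression over $R$ is a nonempty word over $X\cup U(R)$ ($X$ a set of noncommuting variables, $U(R)$ the invertible elements of $R$); its length is the length of the word. A restricted polynomial expression is a finite, possibly empty, formal sum $\sum_j \mu_j$ of restricted monomial expressions; its length is $|p|=\sum_j|\mu_j|$. The expansion of a product $p_1\cdots p_k$ with $p_i=\sum_{j}\mu_{i,j}$ is the formal sum, over all choices of one monomial $\mu_{i,j_i}$ from each $p_i$, of the concatenated words $\mu_{1,j_1}\mu_{2,j_2}\cdots\mu_{k,j_k}$. -}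

module Defs where

open import Level using (Level; _⊔_)
open import Algebra.Bundles using (Ring)
open import Data.Nat using (ℕ)
open import Data.Product using (Σ; Σ-syntax; _×_)
open import Data.Sum using (_⊎_)
open import Data.List using (List; concatMap)
open import Data.Nat.ListAction using (sum)
import Data.List as List
open import Data.List.NonEmpty using (List⁺; _⁺++⁺_; foldr₁)
import Data.List.NonEmpty as List⁺

module _ {c ℓ : Level} (R : Ring c ℓ) where
  open Ring R

  Unit : Set (c ⊔ ℓ)
  Unit = Σ[ u ∈ Carrier ] Σ[ v ∈ Carrier ] ((u * v ≈ 1#) × (v * u ≈ 1#))

  Letter : {x : Level} → Set x → Set (x ⊔ c ⊔ ℓ)
  Letter X = X ⊎ Unit

  RMon : {x : Level} → Set x → Set (x ⊔ c ⊔ ℓ)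
  RMon X = List⁺ (Letter X)

  -- restricted polynomial expression: finite, possibly empty, formal sum of monomials
  RPoly : {x : Level} → Set x → Set (x ⊔ c ⊔ ℓ)
  RPoly X = List (RMon X)

module _ {c ℓ x : Level} (R : Ring c ℓ) (X : Set x) where

  monLength : RMon R X → ℕ
  monLength = List⁺.length

  polyLength : RPoly R X → ℕ
  polyLength p = sum (List.map monLength p)

  expand₂ : RPoly R X → RPoly R X → RPoly R X
  expand₂ p q = concatMap (λ μ → List.map (μ ⁺++⁺_) q) p

  expansion : List⁺ (RPoly R X) → RPoly R X
  expansion = foldr₁ expand₂

module Submission where

open import Defs
open import Level using (Level)
open import Algebra.Bundles using (Ring)
open import Data.Nat using (ℕ; zero; suc; _+_; _*_; _≤_; z≤n; s≤s)
open import Data.Nat.Properties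
open import Data.Nat.ListAction using (sum; product)
open import Data.Nat.ListAction.Properties using (sum-++)
open import Data.Nat.Solver using (module +-*-Solver)
open import Data.List using (List; []; _∷_; _++_; length)
import Data.List as List
open import Data.List.Properties using (map-++; length-++; length-map)
open import Data.List.NonEmpty using (List⁺; _∷_; _⁺++⁺_; toList)
import Data.List.NonEmpty as List⁺
open import Data.Product using (_×_; _,_; proj₂)
open import Relation.Binary.PropositionalEquality using (_≡_; refl; sym; trans; cong; cong₂; module ≡-Reasoning)

-- Writing #p for the number of monomials of p, expansion satisfies
-- |pq| = |p|·#q + #p·|q| and #(pq) = #p·#q.  Monomials are nonempty, so
-- #p ≤ |p|, and the bound follows by induction on k once it is carried
-- together with the companion bound #(p₁⋯p_k) ≤ ∏|pᵢ|.

n≤n*n : ∀ n → n ≤ n * n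
n≤n*n zero    = z≤n
n≤n*n (suc n) = m≤m*n (suc n) (suc n)

module _ {c ℓ x : Level} (R : Ring c ℓ) (X : Set x) where
  open +-*-Solver

  private
    ∣_∣ : RPoly R X → ℕ
    ∣_∣ = polyLength R X

    ‖_‖ : RMon R X → ℕ
    ‖_‖ = monLength R X

  length≤polyLength : ∀ p → length p ≤ ∣ p ∣
  length≤polyLength []      = z≤n
  length≤polyLength (μ ∷ p) = s≤s (≤-trans (length≤polyLength p) (m≤n+m _ _))

  polyLength-++ : ∀ p q → ∣ p ++ q ∣ ≡ ∣ p ∣ + ∣ q ∣
  polyLength-++ p q = trans (cong sum (map-++ ‖_‖ p q)) (sum-++ (List.map ‖_‖ p) (List.map ‖_‖ q))

  monLength-⁺++⁺ : ∀ μ ν → ‖ μ ⁺++⁺ ν ‖ ≡ ‖ μ ‖ + ‖ ν ‖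
  monLength-⁺++⁺ (a ∷ as) (b ∷ bs) = cong suc (length-++ as)

  polyLength-map-⁺++⁺ : ∀ μ q → ∣ List.map (μ ⁺++⁺_) q ∣ ≡ ‖ μ ‖ * length q + ∣ q ∣
  polyLength-map-⁺++⁺ μ []      = sym (trans (+-identityʳ _) (*-zeroʳ ‖ μ ‖))
  polyLength-map-⁺++⁺ μ (ν ∷ q) = begin
    ‖ μ ⁺++⁺ ν ‖ + ∣ List.map (μ ⁺++⁺_) q ∣
      ≡⟨ cong₂ _+_ (monLength-⁺++⁺ μ ν) (polyLength-map-⁺++⁺ μ q) ⟩
    (‖ μ ‖ + ‖ ν ‖) + (‖ μ ‖ * length q + ∣ q ∣)
      ≡⟨ solve 4 (λ m n k l → (m :+ n) :+ (m :* k :+ l) := m :* (con 1 :+ k) :+ (n :+ l))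
               refl ‖ μ ‖ ‖ ν ‖ (length q) ∣ q ∣ ⟩
    ‖ μ ‖ * suc (length q) + (‖ ν ‖ + ∣ q ∣) ∎
    where open ≡-Reasoning

  length-expand₂ : ∀ p q → length (expand₂ R X p q) ≡ length p * length q
  length-expand₂ []      q = refl
  length-expand₂ (μ ∷ p) q =
    trans (length-++ (List.map (μ ⁺++⁺_) q)) (cong₂ _+_ (length-map _ q) (length-expand₂ p q))

  polyLength-expand₂ : ∀ p q → ∣ expand₂ R X p q ∣ ≡ ∣ p ∣ * length q + length p * ∣ q ∣
  polyLength-expand₂ []      q = refl
  polyLength-expand₂ (μ ∷ p) q = begin
    ∣ List.map (μ ⁺++⁺_) q ++ expand₂ R X p q ∣
      ≡⟨ polyLength-++ (List.map (μ ⁺++⁺_) q) (expand₂ R X p q) ⟩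
    ∣ List.map (μ ⁺++⁺_) q ∣ + ∣ expand₂ R X p q ∣
      ≡⟨ cong₂ _+_ (polyLength-map-⁺++⁺ μ q) (polyLength-expand₂ p q) ⟩
    (‖ μ ‖ * length q + ∣ q ∣) + (∣ p ∣ * length q + length p * ∣ q ∣)
      ≡⟨ solve 5 (λ m k l lp np → (m :* k :+ l) :+ (lp :* k :+ np :* l)
                                  := (m :+ lp) :* k :+ (con 1 :+ np) :* l)
               refl ‖ μ ‖ (length q) ∣ q ∣ ∣ p ∣ (length p) ⟩
    (‖ μ ‖ + ∣ p ∣) * length q + suc (length p) * ∣ q ∣ ∎
    where open ≡-Reasoning

  expand₂-bounds : ∀ p e {S P} → length e ≤ P → ∣ e ∣ ≤ S * P →
    length (expand₂ R X p e) ≤ ∣ p ∣ * P × ∣ expand₂ R X p e ∣ ≤ (∣ p ∣ + S) * (∣ p ∣ * P)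
  expand₂-bounds p e {S} {P} #e≤P ∣e∣≤SP = #pe≤aP , ∣pe∣≤[a+S]aP
    where
    a = ∣ p ∣

    #pe≤aP : length (expand₂ R X p e) ≤ a * P
    #pe≤aP = ≤-trans (≤-reflexive (length-expand₂ p e)) (*-mono-≤ (length≤polyLength p) #e≤P)

    ∣pe∣≤[a+S]aP : ∣ expand₂ R X p e ∣ ≤ (a + S) * (a * P)
    ∣pe∣≤[a+S]aP = begin
      ∣ expand₂ R X p e ∣                  ≡⟨ polyLength-expand₂ p e ⟩
      a * length e + length p * ∣ e ∣      ≤⟨ +-mono-≤ (*-monoʳ-≤ a #e≤P) (*-mono-≤ (length≤polyLength p) ∣e∣≤SP) ⟩
      a * P + a * (S * P)                  ≤⟨ +-monoˡ-≤ (a * (S * P)) (*-monoˡ-≤ P (n≤n*n a)) ⟩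
      a * a * P + a * (S * P)              ≡⟨ solve 3 (λ a s p → a :* a :* p :+ a :* (s :* p) := (a :+ s) :* (a :* p))
                                                    refl a S P ⟩
      (a + S) * (a * P)                    ∎
      where open ≤-Reasoning

  private
    Σ∣_∣ Π∣_∣ : List⁺ (RPoly R X) → ℕ
    Σ∣ ps ∣ = sum (toList (List⁺.map ∣_∣ ps))
    Π∣ ps ∣ = product (toList (List⁺.map ∣_∣ ps))

  expansion-bounds : ∀ ps →
    length (expansion R X ps) ≤ Π∣ ps ∣ × ∣ expansion R X ps ∣ ≤ Σ∣ ps ∣ * Π∣ ps ∣
  expansion-bounds (p ∷ ps) = bounds p ps
    where
    bounds : ∀ p ps → length (expansion R X (p ∷ ps)) ≤ Π∣ p ∷ ps ∣
                        × ∣ expansion R X (p ∷ ps) ∣ ≤ Σ∣ p ∷ ps ∣ * Π∣ p ∷ ps ∣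
    bounds p [] =
        ≤-trans (length≤polyLength p) (≤-reflexive (sym (*-identityʳ ∣ p ∣)))
      , ≤-trans (n≤n*n ∣ p ∣) (≤-reflexive (sym (cong₂ _*_ (+-identityʳ ∣ p ∣) (*-identityʳ ∣ p ∣))))
    bounds p (q ∷ ps) with bounds q ps
    ... | #e≤Π , ∣e∣≤ΣΠ = expand₂-bounds p (expansion R X (q ∷ ps)) #e≤Π ∣e∣≤ΣΠ

lemma3p3 : {c ℓ x : Level} (R : Ring c ℓ) (X : Set x) (ps : List⁺ (RPoly R X)) →
    polyLength R X (expansion R X ps)
      ≤ sum (toList (List⁺.map (polyLength R X) ps)) * product (toList (List⁺.map (polyLength R X) ps))
lemma3p3 R X ps = proj₂ (expansion-bounds R X ps)
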